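{- Let $F$ be a Morse stack on a normal $d$-pseudomanifold $M$. Let $x$ be a facet of $M$ and let $\pi$ be a $\Lambda_d$-path in $F$ from $x$ to a face $y\in M$. If $\pi$ has no extension, then $y$ is separating for $F$.
   Context: A simplex is a non-empty finite set; its dimension is its cardinality minus one. A complex is a finite set $X$ of simplexes closed under taking non-empty subsets; elements are faces, facets are faces maximal for inclusion. A covering pair (or $p$-pair) is a pair $(x,y)$ of faces with $x\subseteq y$, $\dim y=p$, $\dim x=p-1$. A path in a set of simplexes is a sequence with consecutive elements comparable for inclusion; a strong $d$-path is a path whose consecutive elements form $d$-pairs (in one order or the other). A subset of $X$ is open if closed under supersets within $X$. A normal $d$-pseudomanifold ($d\ge1$) is a connected complex $M$ whose facets all have dimension $d$, in which each $(d-1)$-face lies in exactly two $d$-faces, and every connected open subset $S$ is strongly connected (any two facets of $S$ joined by a strong $d$-path in $S$). A stack on $X$ is $F:X\to\mathbb Z$ with $F(x)\ge F(y)$ whenever $x\subseteq y$. A flat pair is a covering pair $(x,y)$ with $F(x)=F(y)$; $F$ is a Morse stack if each face is in at most one flat pair. If $(x,y)$ is a covering pair with $F(x)>F(y)$, then $(y,x)$ is a differential pair. $\mathrm{grad}_p(F)$: flat pairs $(x,y)$ with $\dim y=p$; $\mathrm{diff}_p(F)$: differential pairs $(y,x)$ with $\dim y=p$. A $\Lambda_p$-path in $F$ from $x_0$ to $x_k$ is a sequence $\langle x_0,\dots,x_k\rangle$ of faces with each $(x_i,x_{i+1})\in\mathrm{grad}_p(F)\cup\mathrm{diff}_p(F)$.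 A face $z$ is an extension of a $\Lambda_p$-path $\langle x_0,\dots,x_k\rangle$ if $\langle x_0,\dots,x_k,z\rangle$ is a $\Lambda_p$-path. A $(d-1)$-face $y$ of $M$, contained in the two $d$-faces $u,v$, is separating for $F$ if $F(u)<F(y)$ and $F(v)<F(y)$. -}

module Defs where

open import Level using (0ℓ)
open import Data.Nat using (ℕ; zero; suc; _≤_)
open import Data.Integer using (ℤ) renaming (_≤_ to _≤ℤ_; _<_ to _<ℤ_)
open import Data.Fin.Subset using (Subset; _⊆_; ∣_∣; Nonempty)
open import Data.List using (List; []; _∷_; last)
open import Data.List.Relation.Unary.All using (All)
open import Data.List.Relation.Unary.Linked using (Linked)
open import Data.Maybe using (just)
open import Data.Product using (Σ; ∃; _×_; _,_)
open import Data.Sum using (_⊎_)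
open import Relation.Nullary using (¬_)
open import Relation.Unary using (Pred; Decidable)
open import Relation.Binary.PropositionalEquality using (_≡_; _≢_)

-- Vertices are drawn from Fin n; a simplex is a nonempty subset of Fin n,
-- of dimension ∣ s ∣ - 1.  "dim s = p" is rendered as ∣ s ∣ ≡ suc p.

Simplexes : ℕ → Set₁
Simplexes n = Pred (Subset n) 0ℓ

-- A complex: a (finite, hence decidable) set of simplexes, closed under
-- non-empty subsets.
record Complex (n : ℕ) : Set₁ where
  field
    face       : Simplexes n
    face?      : Decidable face
    nonempty   : ∀ {s} → face s → Nonempty s
    down-close : ∀ {s t} → face t → Nonempty s → s ⊆ t → face s
open Complex public

module _ {n : ℕ} where

  IsFacetOf : Simplexes n → Subset n → Set
  IsFacetOf S s = S s × (∀ t → S t → s ⊆ t → t ≡ s)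

  IsFace : Complex n → ℕ → Subset n → Set
  IsFace X p s = face X s × ∣ s ∣ ≡ suc p

  CoveringPair : Complex n → ℕ → Subset n → Subset n → Set
  CoveringPair X p x y = face X x × face X y × x ⊆ y × ∣ y ∣ ≡ suc p × ∣ x ∣ ≡ p

  ChainIn : (Subset n → Subset n → Set) → Simplexes n → Subset n → Subset n → Set
  ChainIn R S a b = Σ (List (Subset n)) λ rest →
    All S (a ∷ rest) × Linked R (a ∷ rest) × last (a ∷ rest) ≡ just b

  Comparable : Subset n → Subset n → Set
  Comparable s t = s ⊆ t ⊎ t ⊆ s

  PathIn : Simplexes n → Subset n → Subset n → Set
  PathIn = ChainIn Comparable

  StrongPathIn : Complex n → ℕ → Simplexes n → Subset n → Subset n → Set
  StrongPathIn X d = ChainIn (λ s t → CoveringPair X d s t ⊎ CoveringPair X d t s)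

  ConnectedSet : Simplexes n → Set
  ConnectedSet S = ∀ a b → S a → S b → PathIn S a b

  StronglyConnected : Complex n → ℕ → Simplexes n → Set
  StronglyConnected X d S =
    ∀ a b → IsFacetOf S a → IsFacetOf S b → StrongPathIn X d S a b

  IsOpen : Complex n → Simplexes n → Set
  IsOpen X S = (∀ s → S s → face X s) × (∀ s t → S s → face X t → s ⊆ t → S t)

  record NormalPseudomanifold (M : Complex n) (d : ℕ) : Set₁ where
    field
      d≥1       : 1 ≤ d
      connected : ConnectedSet (face M)
      facets-d  : ∀ s → IsFacetOf (face M) s → ∣ s ∣ ≡ suc d
      two-cofaces : ∀ y → IsFace M (Data.Nat.pred d) y →
        Σ (Subset n) λ u → Σ (Subset n) λ v →
          u ≢ v × IsFace M d u × IsFace M d v × y ⊆ u × y ⊆ v ×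
          (∀ w → IsFace M d w → y ⊆ w → w ≡ u ⊎ w ≡ v)
      strong    : ∀ (S : Simplexes n) → IsOpen M S → ConnectedSet S →
                  StronglyConnected M d S

  IsStack : Complex n → (Subset n → ℤ) → Set
  IsStack X F = ∀ x y → face X x → face X y → x ⊆ y → F y ≤ℤ F x

  FlatPair : Complex n → (Subset n → ℤ) → Subset n → Subset n → Set
  FlatPair X F x y = (∃ λ p → CoveringPair X p x y) × F x ≡ F y

  IsMorse : Complex n → (Subset n → ℤ) → Set
  IsMorse X F = IsStack X F ×
    (∀ z a b c e → FlatPair X F a b → FlatPair X F c e →
       (z ≡ a ⊎ z ≡ b) → (z ≡ c ⊎ z ≡ e) → a ≡ c × b ≡ e)

  Grad : Complex n → (Subset n → ℤ) → ℕ → Subset n → Subset n → Set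
  Grad X F p x y = CoveringPair X p x y × F x ≡ F y

  Diff : Complex n → (Subset n → ℤ) → ℕ → Subset n → Subset n → Set
  Diff X F p y x = CoveringPair X p x y × F y <ℤ F x

  ΛStep : Complex n → (Subset n → ℤ) → ℕ → Subset n → Subset n → Set
  ΛStep X F p a b = Grad X F p a b ⊎ Diff X F p a b

  IsΛPath : Complex n → (Subset n → ℤ) → ℕ → List (Subset n) → Set
  IsΛPath X F p π = (π ≢ []) × All (face X) π × Linked (ΛStep X F p) π

  FromTo : List (Subset n) → Subset n → Subset n → Set
  FromTo π a b = (Σ (List (Subset n)) λ rest → π ≡ a ∷ rest) × last π ≡ just b

  Separating : Complex n → ℕ → (Subset n → ℤ) → Subset n → Set
  Separating M d F y = IsFace M (Data.Nat.pred d) y ×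
    (Σ (Subset n) λ u → Σ (Subset n) λ v →
       u ≢ v × IsFace M d u × IsFace M d v × y ⊆ u × y ⊆ v ×
       F u <ℤ F y × F v <ℤ F y)

module Submission where

-- A Λ_d-path from a facet ends either at a d-face (after a gradient step or at once) or at a
-- (d-1)-face (after a differential step). If the endpoint y admits no further step, every covering
-- pair through y is forced: a (d-1)-face of y must have the same value as y, and a d-face above y a
-- strictly smaller one. A d-face has two distinct (d-1)-faces, so it would lie in two flat pairs,
-- contradicting the Morse condition; hence y is a (d-1)-face strictly above both of its cofaces.

open import Defs
open import Data.Nat using (ℕ; zero; suc)
open import Data.Nat.Properties using (suc-injective)
open import Data.Integer using (ℤ; _<_)
open import Data.Integer.Properties using (≤∧≢⇒<) renaming (_≟_ to _≟ℤ_)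
open import Data.Fin.Subset using (Subset; _⊆_; ∣_∣; Nonempty; inside; outside)
open import Data.Fin.Subset.Properties
  using (nonempty?; Empty-unique; ∣⊥∣≡0; ⊆-refl; out⊆; in⊆in)
open import Data.Vec using (_∷_)
open import Data.Vec.Properties using (∷-injectiveʳ)
open import Data.List using (List; []; _∷_; _++_; last)
open import Data.List.Properties using (++-conicalʳ)
open import Data.List.Relation.Unary.All using (_∷_; [])
import Data.List.Relation.Unary.All.Properties as All
open import Data.List.Relation.Unary.Linked using (Linked; [-]; _∷_)
import Data.List.Relation.Unary.Linked.Properties as Linked
open import Data.Maybe using (just)
open import Data.Maybe.Relation.Binary.Connected using (Connected; just)
open import Data.Product using (Σ; ∃; _×_; _,_; proj₁; proj₂)
open import Data.Sum using (_⊎_; inj₁; inj₂; [_,_])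
open import Data.Empty using (⊥-elim)
open import Relation.Nullary using (¬_; yes; no; contradiction)
open import Relation.Binary.PropositionalEquality
  using (_≡_; _≢_; refl; sym; trans; cong; subst)

module _ {A : Set} {R : A → A → Set} where

  last-has-predecessor : ∀ {a b y} rest → Linked R (a ∷ b ∷ rest) →
    last (a ∷ b ∷ rest) ≡ just y → ∃ λ c → R c y
  last-has-predecessor []       (r ∷ _) refl = _ , r
  last-has-predecessor (c ∷ rest) (_ ∷ l) e  = last-has-predecessor rest l e

  Linked-∷ʳ : ∀ {xs y z} → Linked R xs → last xs ≡ just y → R y z →
    Linked R (xs ++ z ∷ [])
  Linked-∷ʳ {z = z} l e r =
    Linked.++⁺ l (subst (λ m → Connected R m (just z)) (sym e) (just r)) [-]

module _ {n : ℕ} where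

  ∣p∣≡1+k⇒Nonempty : ∀ {k} (p : Subset n) → ∣ p ∣ ≡ suc k → Nonempty p
  ∣p∣≡1+k⇒Nonempty p ∣p∣≡1+k with nonempty? p
  ... | yes ne = ne
  ... | no  ∅  = contradiction (trans (sym ∣p∣≡1+k) (trans (cong ∣_∣ (Empty-unique ∅)) (∣⊥∣≡0 n)))
                               λ ()

codim₁-subset : ∀ {n k} (p : Subset n) → ∣ p ∣ ≡ suc k → ∃ λ q → q ⊆ p × ∣ q ∣ ≡ k
codim₁-subset (inside  ∷ p) refl = outside ∷ p , out⊆ ⊆-refl , refl
codim₁-subset (outside ∷ p) ∣p∣≡1+k with codim₁-subset p ∣p∣≡1+k
... | q , q⊆p , ∣q∣≡k = outside ∷ q , out⊆ q⊆p , ∣q∣≡k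

two-codim₁-subsets : ∀ {n k} (p : Subset n) → ∣ p ∣ ≡ suc (suc k) →
  Σ (Subset n) λ q → Σ (Subset n) λ r →
    q ≢ r × q ⊆ p × r ⊆ p × ∣ q ∣ ≡ suc k × ∣ r ∣ ≡ suc k
two-codim₁-subsets (inside ∷ p) ∣p∣≡2+k with codim₁-subset p (suc-injective ∣p∣≡2+k)
... | r , r⊆p , ∣r∣≡k =
  outside ∷ p , inside ∷ r , (λ ()) , out⊆ ⊆-refl , in⊆in r⊆p , suc-injective ∣p∣≡2+k , cong suc ∣r∣≡k
two-codim₁-subsets (outside ∷ p) ∣p∣≡2+k with two-codim₁-subsets p ∣p∣≡2+k
... | q , r , q≢r , q⊆p , r⊆p , ∣q∣ , ∣r∣ =
  outside ∷ q , outside ∷ r , (λ eq → q≢r (∷-injectiveʳ eq)) , out⊆ q⊆p , out⊆ r⊆p , ∣q∣ , ∣r∣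

module _ {n : ℕ} (M : Complex n) (F : Subset n → ℤ) where

  ΛTerminal : ℕ → Subset n → Set
  ΛTerminal p y = ∀ z → face M z → ¬ ΛStep M F p y z

  unextendable⇒ΛTerminal : ∀ {p y} (π : List (Subset n)) → IsΛPath M F p π →
    last π ≡ just y → (∀ z → ¬ IsΛPath M F p (π ++ z ∷ [])) → ΛTerminal p y
  unextendable⇒ΛTerminal π (_ , faces , linked) ends-at-y no-extension z z∈M step =
    no-extension z ( (λ eq → contradiction (++-conicalʳ π _ eq) λ ())
                   , All.++⁺ faces (z∈M ∷ [])
                   , Linked-∷ʳ linked ends-at-y step)

  ΛStep-target-dim : ∀ {k b y} → ΛStep M F (suc k) b y → IsFace M (suc k) y ⊎ IsFace M k y
  ΛStep-target-dim (inj₁ ((_ , y∈M , _ , ∣y∣ , _) , _)) = inj₁ (y∈M , ∣y∣)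
  ΛStep-target-dim (inj₂ ((y∈M , _ , _ , _ , ∣y∣) , _)) = inj₂ (y∈M , ∣y∣)

  ΛPath-end-dim : ∀ {k x y} (π : List (Subset n)) → IsΛPath M F (suc k) π →
    FromTo π x y → IsFace M (suc k) x → IsFace M (suc k) y ⊎ IsFace M k y
  ΛPath-end-dim (_ ∷ []) _ ((_ , refl) , refl) x-face = inj₁ x-face
  ΛPath-end-dim (_ ∷ _ ∷ rest) (_ , _ , linked) (_ , ends-at-y) _ =
    let _ , step = last-has-predecessor rest linked ends-at-y in ΛStep-target-dim step

  module _ (stack : IsStack M F) {p y} (terminal : ΛTerminal p y) where

    ΛTerminal⇒flat-below : ∀ {c} → CoveringPair M p c y → F c ≡ F y
    ΛTerminal⇒flat-below {c} cy@(c∈M , y∈M , c⊆y , _) with F y ≟ℤ F c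
    ... | yes Fy≡Fc = sym Fy≡Fc
    ... | no  Fy≢Fc = ⊥-elim (terminal _ c∈M (inj₂ (cy , ≤∧≢⇒< (stack _ _ c∈M y∈M c⊆y) Fy≢Fc)))

    ΛTerminal⇒lower-above : ∀ {w} → CoveringPair M p y w → F w < F y
    ΛTerminal⇒lower-above yw@(y∈M , w∈M , y⊆w , _) =
      ≤∧≢⇒< (stack _ _ y∈M w∈M y⊆w) (λ Fw≡Fy → terminal _ w∈M (inj₁ (yw , sym Fw≡Fy)))

  Morse⇒top-face-not-ΛTerminal : ∀ {k y} → IsMorse M F → IsFace M (suc k) y →
    ¬ ΛTerminal (suc k) y
  Morse⇒top-face-not-ΛTerminal {k} {y} (stack , morse) (y∈M , ∣y∣) terminal
    with two-codim₁-subsets y ∣y∣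
  ... | q , r , q≢r , q⊆y , r⊆y , ∣q∣ , ∣r∣ =
    q≢r (proj₁ (morse y q y r y (flat q⊆y ∣q∣) (flat r⊆y ∣r∣) (inj₂ refl) (inj₂ refl)))
    where
    flat : ∀ {c} → c ⊆ y → ∣ c ∣ ≡ suc k → FlatPair M F c y
    flat {c} c⊆y ∣c∣ = (suc k , cy) , ΛTerminal⇒flat-below stack terminal cy
      where
      cy : CoveringPair M (suc k) c y
      cy = down-close M y∈M (∣p∣≡1+k⇒Nonempty c ∣c∣) c⊆y , y∈M , c⊆y , ∣y∣ , ∣c∣

  ΛTerminal⇒Separating : ∀ {k y} → NormalPseudomanifold M (suc k) → IsStack M F →
    ΛTerminal (suc k) y → IsFace M k y → Separating M (suc k) F y
  ΛTerminal⇒Separating pseudo stack terminal y-face@(y∈M , ∣y∣)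
    with NormalPseudomanifold.two-cofaces pseudo _ y-face
  ... | u , v , u≢v , u-face@(u∈M , ∣u∣) , v-face@(v∈M , ∣v∣) , y⊆u , y⊆v , _ =
    y-face , u , v , u≢v , u-face , v-face , y⊆u , y⊆v ,
    ΛTerminal⇒lower-above stack terminal (y∈M , u∈M , y⊆u , ∣u∣ , ∣y∣) ,
    ΛTerminal⇒lower-above stack terminal (y∈M , v∈M , y⊆v , ∣v∣ , ∣y∣)

proposition5 : (n d : ℕ) (M : Complex n) → NormalPseudomanifold M d →
    (F : Subset n → ℤ) → IsMorse M F →
    (x y : Subset n) → IsFacetOf (face M) x →
    (π : List (Subset n)) → IsΛPath M F d π → FromTo π x y →
    (∀ z → ¬ IsΛPath M F d (π ++ z ∷ [])) →
    Separating M d F y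
proposition5 n zero M pseudo _ _ _ _ _ _ _ _ _ with NormalPseudomanifold.d≥1 pseudo
... | ()
proposition5 n (suc k) M pseudo F morse@(stack , _) x y x-facet π path from-x-to-y no-extension =
  [ (λ y-top → ⊥-elim (Morse⇒top-face-not-ΛTerminal M F morse y-top terminal))
  , ΛTerminal⇒Separating M F pseudo stack terminal
  ] (ΛPath-end-dim M F π path from-x-to-y x-face)
  where
  x-face : IsFace M (suc k) x
  x-face = proj₁ x-facet , NormalPseudomanifold.facets-d pseudo x x-facet
  terminal : ΛTerminal M F (suc k) y
  terminal = unextendable⇒ΛTerminal M F π path (proj₂ from-x-to-y) no-extension
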